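{- Let $m>1$ be an integer and $\mathcal{F}_m$ the Farey sequence of order $m$. (i) Let $j$ be an integer with $\tfrac{1}{j}\in\mathcal{F}_m$ (i.e. $1\le j\le m$). The fraction \[ \frac{\left\lceil\frac{m}{j}\right\rceil-1}{j\left(\left\lceil\frac{m}{j}\right\rceil-1\right)+1} \] immediately precedes $\tfrac{1}{j}$ in $\mathcal{F}_m$. If $j>1$, then the fraction \[ \frac{\left\lceil\frac{m+2}{j}\right\rceil-1}{j\left(\left\lceil\frac{m+2}{j}\right\rceil-1\right)-1} \] immediately succeeds $\tfrac{1}{j}$ in $\mathcal{F}_m$. (ii) Let $j$ be an integer with $\tfrac{j-1}{j}\in\mathcal{F}_m$. If $j>1$, then the fraction \[ \frac{(j-1)\left(\left\lceil\frac{m+2}{j}\right\rceil-1\right)-1}{j\left(\left\lceil\frac{m+2}{j}\right\rceil-1\right)-1} \] immediately precedes $\tfrac{j-1}{j}$ in $\mathcal{F}_m$. The fraction \[ \frac{(j-1)\left(\left\lceil\frac{m}{j}\right\rceil-1\right)+1}{j\left(\left\lceil\frac{m}{j}\right\rceil-1\right)+1} \] immediately succeeds $\tfrac{j-1}{j}$ in $\mathcal{F}_m$.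
   Context: For an integer $m>1$, the Farey sequence $\mathcal{F}_m$ of order $m$ is the ascending sequence of all rational numbers $\tfrac{h}{k}$ written in lowest terms ($\gcd(h,k)=1$) with $0\le \tfrac hk\le 1$ and $1\le k\le m$. "Precedes"/"succeeds" mean being the element immediately before/after in the sequence. -}

module Defs where

open import Data.Nat using (ℕ; zero; suc; _+_; _*_; _∸_; _≤_; _<_; _/_)
open import Data.Nat.Coprimality using (Coprime)
open import Data.Product using (_×_)
open import Relation.Nullary using (¬_)

-- ceiling division ⌈ m / j ⌉ for j ≥ 1 (value at j = 0 is an irrelevant junk value 0)
⌈_/_⌉ : ℕ → ℕ → ℕ
⌈ m / zero ⌉  = 0
⌈ m / suc k ⌉ = (m + k) / suc k

InFarey : ℕ → ℕ → ℕ → Set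
InFarey m h k = Coprime h k × h ≤ k × 1 ≤ k × k ≤ m

FracLt : ℕ → ℕ → ℕ → ℕ → Set
FracLt h k h' k' = h * k' < h' * k

ImmPrecedes : ℕ → ℕ → ℕ → ℕ → ℕ → Set
ImmPrecedes m h k h' k' =
  InFarey m h k × InFarey m h' k' × FracLt h k h' k' ×
  (∀ h'' k'' → InFarey m h'' k'' → ¬ (FracLt h k h'' k'' × FracLt h'' k'' h' k'))

{-# OPTIONS --safe #-}
module Submission where

-- Two fractions a/b < h/k with b h − a k = 1 are neighbours in 𝓕_m as soon as both lie in
-- 𝓕_m and b + k > m: any fraction strictly between them has denominator at least b + k.
-- Each fraction of the statement forms such a unimodular pair with 1/j or (j − 1)/j, its
-- denominator being D = j c ± 1 with c = ⌈n/j⌉ − 1 for n = m resp. m + 2, and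
-- j c < n ≤ j (c + 1) says exactly that m − j < D ≤ m.

open import Defs
open import Data.Nat using (ℕ; zero; suc; _+_; _*_; _∸_; _≤_; _<_; z≤n; s≤s; s≤s⁻¹; >-nonZero)
open import Data.Nat.Properties
open import Data.Nat.DivMod using (m≡m%n+[m/n]*n; m%n<n)
open import Data.Nat.Divisibility using (_∣_; ∣1⇒≡1; ∣m+n∣m⇒∣n; ∣-trans; m∣m*n)
open import Data.Nat.Coprimality as Coprime using (Coprime)
open import Data.Nat.Tactic.RingSolver using (solve)
open import Data.List using ([]; _∷_)
open import Data.Product using (_×_; _,_; ∃-syntax)
open import Relation.Nullary using (contradiction)
open import Relation.Binary.PropositionalEquality using (_≡_; refl; sym; trans; cong; subst)

unimodular⇒coprime : ∀ {a b c d} → a * b ≡ c * d + 1 → Coprime a c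
unimodular⇒coprime {b = b} {d = d} eq {x} (x∣a , x∣c) =
  ∣1⇒≡1 (∣m+n∣m⇒∣n (subst (x ∣_) eq (∣-trans x∣a (m∣m*n b))) (∣-trans x∣c (m∣m*n d)))

unimodular⇒FracLt : ∀ {a b h k} → b * h ≡ a * k + 1 → FracLt a b h k
unimodular⇒FracLt {a} {b} {h} {k} eq = ≤-reflexive (trans (+-comm 1 (a * k)) (trans (sym eq) (*-comm b h)))

unimodular-between⇒sum≤denominator : ∀ {a b h k h′ k′} → b * h ≡ a * k + 1 →
  FracLt a b h′ k′ → FracLt h′ k′ h k → b + k ≤ k′
unimodular-between⇒sum≤denominator {a} {b} {h} {k} {h′} {k′} eq a/b<h′/k′ h′/k′<h/k =
  +-cancelˡ-≤ (a * k * k′) (b + k) k′ (begin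
    a * k * k′ + (b + k)   ≡⟨ solve (a ∷ b ∷ k ∷ k′ ∷ []) ⟩
    k * suc (a * k′) + b   ≤⟨ +-monoˡ-≤ b (*-monoʳ-≤ k a/b<h′/k′) ⟩
    k * (h′ * b) + b       ≡⟨ solve (b ∷ k ∷ h′ ∷ []) ⟩
    b * suc (h′ * k)       ≤⟨ *-monoʳ-≤ b h′/k′<h/k ⟩
    b * (h * k′)           ≡⟨ sym (*-assoc b h k′) ⟩
    b * h * k′             ≡⟨ cong (_* k′) eq ⟩
    (a * k + 1) * k′       ≡⟨ solve (a ∷ k ∷ k′ ∷ []) ⟩
    a * k * k′ + k′        ∎)
  where open ≤-Reasoning

unimodular⇒ImmPrecedes : ∀ {m a b h k} → b * h ≡ a * k + 1 →
  a ≤ b → h ≤ k → 1 ≤ b → 1 ≤ k → b ≤ m → k ≤ m → m < b + k → ImmPrecedes m a b h k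
unimodular⇒ImmPrecedes {a = a} {b} {h} {k} eq a≤b h≤k 1≤b 1≤k b≤m k≤m m<b+k =
  (Coprime.sym (unimodular⇒coprime eq) , a≤b , 1≤b , b≤m) ,
  (unimodular⇒coprime eq′ , h≤k , 1≤k , k≤m) ,
  unimodular⇒FracLt {a} {b} {h} {k} eq ,
  λ { h″ _ (_ , _ , _ , k″≤m) (lt₁ , lt₂) →
        <⇒≱ m<b+k (≤-trans (unimodular-between⇒sum≤denominator {a} {b} {h} {k} {h″} eq lt₁ lt₂) k″≤m) }
  where
  eq′ : h * b ≡ k * a + 1
  eq′ = trans (*-comm h b) (trans eq (cong (_+ 1) (*-comm a k)))

quotient-bracket : ∀ {n k q r} → 1 ≤ n → r ≤ k → n + k ≡ r + q * suc k →
  ∃[ c ] q ≡ suc c × suc k * c < n × n ≤ suc k * suc c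
quotient-bracket {n} {k} {zero} {r} 1≤n r≤k eq =
  contradiction (≤-trans (≤-reflexive (trans eq (+-identityʳ r))) r≤k) (<⇒≱ (+-monoˡ-≤ k 1≤n))
quotient-bracket {n} {k} {suc c} {r} 1≤n r≤k eq = c , refl , lower , upper
  where
  open ≤-Reasoning
  lower : suc k * c < n
  lower = +-cancelʳ-≤ k (suc (suc k * c)) n (begin
    suc (suc k * c) + k   ≡⟨ solve (k ∷ c ∷ []) ⟩
    suc c * suc k         ≤⟨ m≤n+m _ r ⟩
    r + suc c * suc k     ≡⟨ sym eq ⟩
    n + k                 ∎)
  upper : n ≤ suc k * suc c
  upper = +-cancelʳ-≤ k n (suc k * suc c) (begin
    n + k                 ≡⟨ eq ⟩
    r + suc c * suc k     ≤⟨ +-monoˡ-≤ _ r≤k ⟩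
    k + suc c * suc k     ≡⟨ solve (k ∷ c ∷ []) ⟩
    suc k * suc c + k     ∎)

⌈/⌉-bracket : ∀ {n k} → 1 ≤ n → ∃[ c ] ⌈ n / suc k ⌉ ≡ suc c × suc k * c < n × n ≤ suc k * suc c
⌈/⌉-bracket {n} {k} 1≤n =
  quotient-bracket 1≤n (s≤s⁻¹ (m%n<n (n + k) (suc k))) (m≡m%n+[m/n]*n (n + k) (suc k))

-- d = j c + (m + 1) − n, stated without subtraction.
ceiling-window : ∀ {m n j c d} → d + n ≡ j * c + suc m → j * c < n → n ≤ j * suc c →
  d ≤ m × m < d + j
ceiling-window {m} {n} {j} {c} {d} eq lower upper = d≤m , m<d+j
  where
  open ≤-Reasoning
  d≤m : d ≤ m
  d≤m = +-cancelʳ-≤ n d m (begin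
    d + n            ≡⟨ trans eq (+-suc (j * c) m) ⟩
    suc (j * c) + m  ≤⟨ +-monoˡ-≤ m lower ⟩
    n + m            ≡⟨ +-comm n m ⟩
    m + n            ∎)
  m<d+j : m < d + j
  m<d+j = +-cancelʳ-≤ n (suc m) (d + j) (begin
    suc m + n              ≤⟨ +-monoʳ-≤ (suc m) upper ⟩
    suc m + j * suc c      ≡⟨ solve (m ∷ j ∷ c ∷ []) ⟩
    j + (j * c + suc m)    ≡⟨ cong (j +_) (sym eq) ⟩
    j + (d + n)            ≡⟨ solve (j ∷ d ∷ n ∷ []) ⟩
    d + j + n              ∎)

window-jc+1 : ∀ {m k c} → suc k * c < m → m ≤ suc k * suc c →
  suc k * c + 1 ≤ m × m < suc k * c + 1 + suc k
window-jc+1 {m} {k} {c} = ceiling-window (+-assoc (suc k * c) 1 m)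

window-jc∸1 : ∀ {m k e} → suc k * suc e < m + 2 → m + 2 ≤ suc k * suc (suc e) →
  suc k * suc e ∸ 1 ≤ m × m < suc k * suc e ∸ 1 + suc k
window-jc∸1 {m} {k} {e} = ceiling-window shift
  where
  shift : e + k * suc e + (m + 2) ≡ suc k * suc e + suc m
  shift = solve (m ∷ k ∷ e ∷ [])

⌈m+2/j⌉-bracket : ∀ {m k} → suc k ≤ m →
  ∃[ e ] ⌈ m + 2 / suc k ⌉ ≡ suc (suc e) × suc k * suc e < m + 2 × m + 2 ≤ suc k * suc (suc e)
⌈m+2/j⌉-bracket {m} {k} j≤m with ⌈/⌉-bracket {m + 2} {k} (≤-trans (s≤s z≤n) (m≤n+m 2 m))
... | zero , _ , _ , upper =
  contradiction upper (<⇒≱ (≤-trans (s≤s j*1≤m) (≤-trans (n≤1+n (suc m)) (≤-reflexive (+-comm 2 m)))))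
  where
  j*1≤m : suc k * 1 ≤ m
  j*1≤m = ≤-trans (≤-reflexive (*-identityʳ (suc k))) j≤m
... | suc e , ceq , lower , upper = e , ceq , lower , upper

unitFraction-predecessor : ∀ {m k c} → suc k ≤ m → suc k * c < m → m ≤ suc k * suc c →
  ImmPrecedes m c (suc k * c + 1) 1 (suc k)
unitFraction-predecessor {m} {k} {c} j≤m lower upper
  with window-jc+1 {m} {k} {c} lower upper
... | b≤m , m<b+j =
  unimodular⇒ImmPrecedes det (≤-trans (m≤n*m c (suc k)) (m≤m+n _ 1)) (s≤s z≤n)
    (m≤n+m 1 _) (s≤s z≤n) b≤m j≤m m<b+j
  where
  det : (suc k * c + 1) * 1 ≡ c * suc k + 1
  det = solve (k ∷ c ∷ [])

complement-successor : ∀ {m k c} → suc k ≤ m → suc k * c < m → m ≤ suc k * suc c →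
  ImmPrecedes m k (suc k) (k * c + 1) (suc k * c + 1)
complement-successor {m} {k} {c} j≤m lower upper
  with window-jc+1 {m} {k} {c} lower upper
... | k≤m , m<k+j =
  unimodular⇒ImmPrecedes det (n≤1+n k) (+-monoˡ-≤ 1 (*-monoˡ-≤ c (n≤1+n k)))
    (s≤s z≤n) (m≤n+m 1 _) j≤m k≤m (≤-trans m<k+j (≤-reflexive (+-comm _ (suc k))))
  where
  det : suc k * (k * c + 1) ≡ k * (suc k * c + 1) + 1
  det = solve (k ∷ c ∷ [])

-- With c = suc e, the denominator suc k * suc e ∸ 1 reduces to e + k * suc e.
unitFraction-successor : ∀ {m k e} → 1 ≤ k → suc k ≤ m →
  suc k * suc e < m + 2 → m + 2 ≤ suc k * suc (suc e) →
  ImmPrecedes m 1 (suc k) (suc e) (suc k * suc e ∸ 1)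
unitFraction-successor {m} {k} {e} 1≤k j≤m lower upper
  with window-jc∸1 {m} {k} {e} lower upper
... | k≤m , m<k+j =
  unimodular⇒ImmPrecedes det (s≤s z≤n) h≤k (s≤s z≤n) (≤-trans (s≤s z≤n) h≤k) j≤m k≤m
    (≤-trans m<k+j (≤-reflexive (+-comm _ (suc k))))
  where
  det : suc k * suc e ≡ 1 * (e + k * suc e) + 1
  det = solve (k ∷ e ∷ [])
  h≤k : suc e ≤ e + k * suc e
  h≤k = ≤-trans (m≤n*m (suc e) k {{>-nonZero 1≤k}}) (m≤n+m _ e)

complement-predecessor : ∀ {m k e} → 1 ≤ k → suc k ≤ m →
  suc k * suc e < m + 2 → m + 2 ≤ suc k * suc (suc e) →
  ImmPrecedes m (k * suc e ∸ 1) (suc k * suc e ∸ 1) k (suc k)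
complement-predecessor {m} {suc i} {e} _ j≤m lower upper
  with window-jc∸1 {m} {suc i} {e} lower upper
... | b≤m , m<b+j =
  unimodular⇒ImmPrecedes det (+-monoʳ-≤ e (*-monoˡ-≤ (suc e) (n≤1+n i))) (n≤1+n (suc i))
    (≤-trans (s≤s z≤n) (m≤n+m _ e)) (s≤s z≤n) b≤m j≤m m<b+j
  where
  det : (e + suc i * suc e) * suc i ≡ (e + i * suc e) * suc (suc i) + 1
  det = solve (i ∷ e ∷ [])

unitFraction-neighbours : ∀ {m k} → suc k ≤ m →
  ImmPrecedes m (⌈ m / suc k ⌉ ∸ 1) (suc k * (⌈ m / suc k ⌉ ∸ 1) + 1) 1 (suc k)
  × (1 < suc k →
     ImmPrecedes m 1 (suc k) (⌈ m + 2 / suc k ⌉ ∸ 1) (suc k * (⌈ m + 2 / suc k ⌉ ∸ 1) ∸ 1))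
unitFraction-neighbours {m} {k} j≤m
  with ⌈/⌉-bracket {m} {k} (≤-trans (s≤s z≤n) j≤m) | ⌈m+2/j⌉-bracket {m} {k} j≤m
... | c , ceq , lower , upper | e , ceq′ , lower′ , upper′ rewrite ceq | ceq′ =
  unitFraction-predecessor j≤m lower upper ,
  λ 1<j → unitFraction-successor (s≤s⁻¹ 1<j) j≤m lower′ upper′

complement-neighbours : ∀ {m k} → suc k ≤ m →
  (1 < suc k →
     ImmPrecedes m (k * (⌈ m + 2 / suc k ⌉ ∸ 1) ∸ 1) (suc k * (⌈ m + 2 / suc k ⌉ ∸ 1) ∸ 1) k (suc k))
  × ImmPrecedes m k (suc k) (k * (⌈ m / suc k ⌉ ∸ 1) + 1) (suc k * (⌈ m / suc k ⌉ ∸ 1) + 1)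
complement-neighbours {m} {k} j≤m
  with ⌈/⌉-bracket {m} {k} (≤-trans (s≤s z≤n) j≤m) | ⌈m+2/j⌉-bracket {m} {k} j≤m
... | c , ceq , lower , upper | e , ceq′ , lower′ , upper′ rewrite ceq | ceq′ =
  (λ 1<j → complement-predecessor (s≤s⁻¹ 1<j) j≤m lower′ upper′) ,
  complement-successor j≤m lower upper

corollary3p2 : (m : ℕ) → 1 < m →
    ((j : ℕ) → InFarey m 1 j →
      ImmPrecedes m (⌈ m / j ⌉ ∸ 1) (j * (⌈ m / j ⌉ ∸ 1) + 1) 1 j
      × (1 < j → ImmPrecedes m 1 j (⌈ m + 2 / j ⌉ ∸ 1) (j * (⌈ m + 2 / j ⌉ ∸ 1) ∸ 1)))
    × ((j : ℕ) → InFarey m (j ∸ 1) j →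
      (1 < j → ImmPrecedes m ((j ∸ 1) * (⌈ m + 2 / j ⌉ ∸ 1) ∸ 1) (j * (⌈ m + 2 / j ⌉ ∸ 1) ∸ 1) (j ∸ 1) j)
      × ImmPrecedes m (j ∸ 1) j ((j ∸ 1) * (⌈ m / j ⌉ ∸ 1) + 1) (j * (⌈ m / j ⌉ ∸ 1) + 1))
corollary3p2 m _ =
  (λ { zero (_ , _ , () , _) ; (suc k) (_ , _ , _ , j≤m) → unitFraction-neighbours j≤m }) ,
  (λ { zero (_ , _ , () , _) ; (suc k) (_ , _ , _ , j≤m) → complement-neighbours j≤m })
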